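{- For every set of formulas $\Gamma\cup\{A\}\subseteq For(\Sigma)$: $\Gamma\models_{\mathcal{M}_{LET_K}} A$ if and only if $\Gamma\vdash_{LET_K} A$.
   Context: Fix a denumerable set of propositional variables and let $For(\Sigma)$ be the set of formulas over $\Sigma=\{\land,\lor,\to,\neg,\circ\}$. The logic $LET_K$ is given by the natural deduction system with the following rules (derivations defined as usual; bracketed hypotheses are discharged); $\Gamma\vdash_{LET_K}A$ means $A$ is derivable from premises in $\Gamma$: ($\land$I) from $A$ and $B$ infer $A\land B$; ($\land$E) from $A\land B$ infer $A$, and infer $B$; ($\lor$I) from $A$ infer $A\lor B$, from $B$ infer $A\lor B$; ($\lor$E) from $A\lor B$, a derivation of $C$ from $[A]$ and a derivation of $C$ from $[B]$, infer $C$; ($\neg\land$I) from $\neg A$ infer $\neg(A\land B)$, from $\neg B$ infer $\neg(A\land B)$; ($\neg\land$E) from $\neg(A\land B)$, a derivation of $C$ from $[\neg A]$ and one of $C$ from $[\neg B]$, infer $C$; ($\neg\lor$I) from $\neg A$ and $\neg B$ infer $\neg(A\lor B)$; ($\neg\lor$E) from $\neg(A\lor B)$ infer $\neg A$, and infer $\neg B$; (DN) from $A$ infer $\neg\neg A$, and from $\neg\neg A$ infer $A$; ($\to$I) from a derivation of $B$ from $[A]$ infer $A\to B$; ($\to$E) from $A\to B$ and $A$ infer $B$; ($\to_{CL}$) axiom $A\lor(A\to B)$; ($\neg\to$I) from $A$ and $\neg B$ infer $\neg(A\to B)$; ($\neg\to$E) from $\neg(A\to B)$ infer $A$, and infer $\neg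 B$; (EXP$^\circ$) from $\circ A$, $A$, $\neg A$ infer $B$; (PEM$^\circ$) from $\circ A$ infer $A\lor\neg A$. Let $\{0,1\}$ be the two-element Boolean algebra with $\sqcap,\sqcup,\sim$ and $a\Rightarrow b=\sim a\sqcup b$. An Nmatrix is a triple $(M,\mathrm{D},\mathcal{O})$ with $\emptyset\ne\mathrm{D}\subseteq M$ and $\mathcal{O}(\#):M^n\to\wp(M)\setminus\{\emptyset\}$ for each $n$-ary connective $\#$; a valuation is a map $v$ with $v(\#(A_1,\dots,A_n))\in\mathcal{O}(\#)(v(A_1),\dots,v(A_n))$; $\Gamma\models A$ iff every valuation mapping all of $\Gamma$ into $\mathrm{D}$ maps $A$ into $\mathrm{D}$. The Nmatrix $\mathcal{M}_{LET_K}$ has domain $B_{LET_K}=\{z\in\{0,1\}^3: z_3\le z_1\sqcup z_2,\ z_1\sqcap z_2\sqcap z_3=0\}=\{T=(1,0,1),T_0=(1,0,0),\mathsf{b}=(1,1,0),\mathsf{n}=(0,0,0),F_0=(0,1,0),F=(0,1,1)\}$, designated set $\mathrm{D}=\{T,T_0,\mathsf{b}\}$, and multioperations ($u$ ranging over $B_{LET_K}$): $z\tilde\land w=\{u:u_1=z_1\sqcap w_1,u_2=z_2\sqcup w_2\}$; $z\tilde\lor w=\{u:u_1=z_1\sqcup w_1,u_2=z_2\sqcap w_2\}$; $z\tilde\to w=\{u:u_1=z_1\Rightarrow w_1,u_2=z_1\sqcap w_2\}$; $\tilde\neg z=\{u:u_1=z_2,u_2=z_1\}$; $\tilde\circ z=\{u:u_1=z_3\}$.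 -}

module Defs where

open import Data.Nat.Base using (ℕ)
open import Data.Bool.Base using (Bool; true; false; _∧_; _∨_; not; _≤_)
open import Data.Sum.Base using (_⊎_)
open import Data.Product.Base using (_×_)
open import Relation.Binary.PropositionalEquality using (_≡_)

infixr 5 _⇒_
infixr 6 _∨'_
infixr 7 _∧'_

data Formula : Set where
  var   : ℕ → Formula
  _∧'_  : Formula → Formula → Formula
  _∨'_  : Formula → Formula → Formula
  _⇒_   : Formula → Formula → Formula
  ¬'_   : Formula → Formula
  ∘'_   : Formula → Formula

FSet : Set₁
FSet = Formula → Set

_,,_ : FSet → Formula → FSet
(Γ ,, A) B = Γ B ⊎ B ≡ A

infixl 4 _,,_
infix 9 ¬'_ ∘'_
infix 3 _⊢_

data _⊢_ : FSet → Formula → Set₁ where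
  hyp   : ∀ {Γ A} → Γ A → Γ ⊢ A
  ∧I    : ∀ {Γ A B} → Γ ⊢ A → Γ ⊢ B → Γ ⊢ A ∧' B
  ∧E₁   : ∀ {Γ A B} → Γ ⊢ A ∧' B → Γ ⊢ A
  ∧E₂   : ∀ {Γ A B} → Γ ⊢ A ∧' B → Γ ⊢ B
  ∨I₁   : ∀ {Γ A B} → Γ ⊢ A → Γ ⊢ A ∨' B
  ∨I₂   : ∀ {Γ A B} → Γ ⊢ B → Γ ⊢ A ∨' B
  ∨E    : ∀ {Γ A B C} → Γ ⊢ A ∨' B → (Γ ,, A) ⊢ C → (Γ ,, B) ⊢ C → Γ ⊢ C
  ¬∧I₁  : ∀ {Γ A B} → Γ ⊢ ¬' A → Γ ⊢ ¬' (A ∧' B)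
  ¬∧I₂  : ∀ {Γ A B} → Γ ⊢ ¬' B → Γ ⊢ ¬' (A ∧' B)
  ¬∧E   : ∀ {Γ A B C} → Γ ⊢ ¬' (A ∧' B) → (Γ ,, ¬' A) ⊢ C → (Γ ,, ¬' B) ⊢ C → Γ ⊢ C
  ¬∨I   : ∀ {Γ A B} → Γ ⊢ ¬' A → Γ ⊢ ¬' B → Γ ⊢ ¬' (A ∨' B)
  ¬∨E₁  : ∀ {Γ A B} → Γ ⊢ ¬' (A ∨' B) → Γ ⊢ ¬' A
  ¬∨E₂  : ∀ {Γ A B} → Γ ⊢ ¬' (A ∨' B) → Γ ⊢ ¬' B
  DNI   : ∀ {Γ A} → Γ ⊢ A → Γ ⊢ ¬' ¬' A
  DNE   : ∀ {Γ A} → Γ ⊢ ¬' ¬' A → Γ ⊢ A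
  ⇒I    : ∀ {Γ A B} → (Γ ,, A) ⊢ B → Γ ⊢ A ⇒ B
  ⇒E    : ∀ {Γ A B} → Γ ⊢ A ⇒ B → Γ ⊢ A → Γ ⊢ B
  ⇒CL   : ∀ {Γ A B} → Γ ⊢ A ∨' (A ⇒ B)
  ¬⇒I   : ∀ {Γ A B} → Γ ⊢ A → Γ ⊢ ¬' B → Γ ⊢ ¬' (A ⇒ B)
  ¬⇒E₁  : ∀ {Γ A B} → Γ ⊢ ¬' (A ⇒ B) → Γ ⊢ A
  ¬⇒E₂  : ∀ {Γ A B} → Γ ⊢ ¬' (A ⇒ B) → Γ ⊢ ¬' B
  EXP∘  : ∀ {Γ A B} → Γ ⊢ ∘' A → Γ ⊢ A → Γ ⊢ ¬' A → Γ ⊢ B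
  PEM∘  : ∀ {Γ A} → Γ ⊢ ∘' A → Γ ⊢ A ∨' ¬' A

-- Domain B_{LET_K} ⊆ {0,1}^3 (0 = false, 1 = true).
record B : Set where
  constructor ⟨_,_,_⟩[_,_]
  field
    z₁ z₂ z₃ : Bool
    cond₁ : z₃ ≤ (z₁ ∨ z₂)
    cond₂ : (z₁ ∧ z₂ ∧ z₃) ≡ false
open B public

_⇛_ : Bool → Bool → Bool
a ⇛ b = not a ∨ b

-- Designated set D = {T = (1,0,1), T₀ = (1,0,0), b = (1,1,0)}.
Designated : B → Set
Designated z =
    (z₁ z ≡ true × z₂ z ≡ false × z₃ z ≡ true)
  ⊎ (z₁ z ≡ true × z₂ z ≡ false × z₃ z ≡ false)
  ⊎ (z₁ z ≡ true × z₂ z ≡ true  × z₃ z ≡ false)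

-- Multioperations, written as membership relations  u ∈ O(#)(z, w).
_∈∧̃_,_ : B → B → B → Set
u ∈∧̃ z , w = z₁ u ≡ (z₁ z ∧ z₁ w) × z₂ u ≡ (z₂ z ∨ z₂ w)

_∈∨̃_,_ : B → B → B → Set
u ∈∨̃ z , w = z₁ u ≡ (z₁ z ∨ z₁ w) × z₂ u ≡ (z₂ z ∧ z₂ w)

_∈→̃_,_ : B → B → B → Set
u ∈→̃ z , w = z₁ u ≡ (z₁ z ⇛ z₁ w) × z₂ u ≡ (z₁ z ∧ z₂ w)

_∈¬̃_ : B → B → Set
u ∈¬̃ z = z₁ u ≡ z₂ z × z₂ u ≡ z₁ z

_∈∘̃_ : B → B → Set
u ∈∘̃ z = z₁ u ≡ z₃ z

record Valuation : Set where
  field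
    v    : Formula → B
    v-∧  : ∀ A C → v (A ∧' C) ∈∧̃ v A , v C
    v-∨  : ∀ A C → v (A ∨' C) ∈∨̃ v A , v C
    v-⇒  : ∀ A C → v (A ⇒ C)  ∈→̃ v A , v C
    v-¬  : ∀ A   → v (¬' A) ∈¬̃ v A
    v-∘  : ∀ A   → v (∘' A) ∈∘̃ v A
open Valuation public

infix 3 _⊨_
_⊨_ : FSet → Formula → Set
Γ ⊨ A = (val : Valuation) →
        (∀ B → Γ B → Designated (v val B)) → Designated (v val A)

-- Both sides are compared with a two-valued "bivaluation" semantics: the
-- first coordinate of a valuation into M_{LET_K} obeys classical clauses for
-- ∧, ∨, → and De Morgan-style clauses for negated formulas, and conversely
-- any Boolean function obeying those clauses is the first coordinate of the
-- valuation X ↦ (b X, b ¬X, b ∘X).  For completeness, if A is not derivable from Γ we enumerate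
-- the formulas and extend Γ, one formula at a time, to a set Δ maximal among
-- those not deriving A; such a Δ is closed under derivability and prime, so
-- its characteristic function is a bivaluation that designates Γ but not A.
module Submission where

open import Defs
open import Level using (0ℓ)
open import Axiom.ExcludedMiddle using (ExcludedMiddle)
open import Function.Bundles using (_⇔_; mk⇔; Equivalence)

open import Data.Bool.Base using (Bool; true; false; _∧_; _∨_; _≤_; b≤b; f≤t; T)
open import Data.Bool.Properties using (T-∧; T-∨; T?; ≤-minimum)
open import Data.Empty using (⊥; ⊥-elim)
open import Data.List.Base using (List; []; _∷_; head)
open import Data.List.Membership.Propositional using (_∈_)
open import Data.List.Relation.Unary.Any using (here; there)
open import Data.Maybe.Base using (fromMaybe)
open import Data.Nat.Base using (ℕ; zero; suc; _⊔_; _≤′_; ≤′-reflexive; ≤′-step) renaming (_≤_ to _≤ℕ_)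
open import Data.Nat.Binary.Base using (ℕᵇ; 2[1+_]; 1+[2_]; toℕ; fromℕ) renaming (zero to 0ᵇ)
open import Data.Nat.Binary.Properties using (fromℕ-toℕ)
open import Data.Nat.Properties using (≤⇒≤′; m≤m⊔n; m≤n⊔m; ≤-trans)
open import Data.Product.Base using (_×_; _,_; proj₁; proj₂; Σ)
open import Data.Sum.Base using (_⊎_; inj₁; inj₂; [_,_]) renaming (map₁ to ⊎-map₁; map₂ to ⊎-map₂)
open import Function.Base using (_∘_; id)
open import Relation.Binary.PropositionalEquality using (_≡_; refl; sym; trans; cong; cong₂; subst; subst₂)
open import Relation.Nullary using (¬_; Dec; yes; no; does; _×-dec_; _⊎-dec_; _→-dec_)
open import Relation.Nullary.Decidable using (does-⇔; dec-false)
open import Relation.Unary using (_⊆_; ⋃)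

open Equivalence using (to; from)

T-⇛ : ∀ {x y} → T (x ⇛ y) ⇔ (T x → T y)
T-⇛ {true}  = mk⇔ (λ y _ → y) (λ f → f _)
T-⇛ {false} = mk⇔ (λ _ ()) _

T-≤ : ∀ {x y} → x ≤ y → T x → T y
T-≤ b≤b = id
T-≤ f≤t = _

T-≡⇔ : ∀ {x y} {Q : Set} → x ≡ y → T y ⇔ Q → T x ⇔ Q
T-≡⇔ refl e = e

T-does : ∀ {P : Set} (p : Dec P) → T (does p) ⇔ P
T-does (yes p) = mk⇔ (λ _ → p) _
T-does (no ¬p) = mk⇔ (λ ()) ¬p

does-mono : ∀ {P Q : Set} → (P → Q) → (p : Dec P) (q : Dec Q) → does p ≤ does q
does-mono f (no _)  q       = ≤-minimum (does q)
does-mono f (yes _) (yes _) = b≤b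
does-mono f (yes p) (no ¬q) = ⊥-elim (¬q (f p))

-- Bivaluation semantics

record IsBivaluation (b : Formula → Bool) : Set where
  field
    b-∧  : ∀ A C → b (A ∧' C) ≡ b A ∧ b C
    b-∨  : ∀ A C → b (A ∨' C) ≡ b A ∨ b C
    b-⇒  : ∀ A C → b (A ⇒ C) ≡ b A ⇛ b C
    b-¬¬ : ∀ A → b (¬' ¬' A) ≡ b A
    b-¬∧ : ∀ A C → b (¬' (A ∧' C)) ≡ b (¬' A) ∨ b (¬' C)
    b-¬∨ : ∀ A C → b (¬' (A ∨' C)) ≡ b (¬' A) ∧ b (¬' C)
    b-¬⇒ : ∀ A C → b (¬' (A ⇒ C)) ≡ b A ∧ b (¬' C)
    b-∘₁ : ∀ A → b (∘' A) ≤ b A ∨ b (¬' A)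
    b-∘₂ : ∀ A → b A ∧ b (¬' A) ∧ b (∘' A) ≡ false

valuation-isBivaluation : (val : Valuation) → IsBivaluation (z₁ ∘ v val)
valuation-isBivaluation val = record
  { b-∧  = λ A C → proj₁ (v-∧ val A C)
  ; b-∨  = λ A C → proj₁ (v-∨ val A C)
  ; b-⇒  = λ A C → proj₁ (v-⇒ val A C)
  ; b-¬¬ = λ A → trans (¬-z₁ (¬' A)) (proj₂ (v-¬ val A))
  ; b-¬∧ = λ A C → trans (¬-z₁ (A ∧' C)) (trans (proj₂ (v-∧ val A C)) (sym (cong₂ _∨_ (¬-z₁ A) (¬-z₁ C))))
  ; b-¬∨ = λ A C → trans (¬-z₁ (A ∨' C)) (trans (proj₂ (v-∨ val A C)) (sym (cong₂ _∧_ (¬-z₁ A) (¬-z₁ C))))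
  ; b-¬⇒ = λ A C → trans (¬-z₁ (A ⇒ C)) (trans (proj₂ (v-⇒ val A C)) (cong (z₁ (v val A) ∧_) (sym (¬-z₁ C))))
  ; b-∘₁ = λ A → subst₂ _≤_ (sym (v-∘ val A)) (cong (z₁ (v val A) ∨_) (sym (¬-z₁ A))) (cond₁ (v val A))
  ; b-∘₂ = λ A → trans (cong₂ (λ x y → z₁ (v val A) ∧ x ∧ y) (¬-z₁ A) (v-∘ val A)) (cond₂ (v val A))
  }
  where
  ¬-z₁ : ∀ A → z₁ (v val (¬' A)) ≡ z₂ (v val A)
  ¬-z₁ A = proj₁ (v-¬ val A)

toValuation : ∀ {b} → IsBivaluation b → Valuation
toValuation {b} bv = record
  { v   = λ X → ⟨ b X , b (¬' X) , b (∘' X) ⟩[ b-∘₁ X , b-∘₂ X ]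
  ; v-∧ = λ A C → b-∧ A C , b-¬∧ A C
  ; v-∨ = λ A C → b-∨ A C , b-¬∨ A C
  ; v-⇒ = λ A C → b-⇒ A C , b-¬⇒ A C
  ; v-¬ = λ A → refl , b-¬¬ A
  ; v-∘ = λ A → refl
  }
  where open IsBivaluation bv

designated⇔z₁ : ∀ z → Designated z ⇔ T (z₁ z)
designated⇔z₁ z = mk⇔ to′ (from′ z)
  where
  to′ : Designated z → T (z₁ z)
  to′ (inj₁ (refl , _))        = _
  to′ (inj₂ (inj₁ (refl , _))) = _
  to′ (inj₂ (inj₂ (refl , _))) = _
  from′ : ∀ z → T (z₁ z) → Designated z
  from′ ⟨ true , false , true  ⟩[ _ , _ ] _ = inj₁ (refl , refl , refl)
  from′ ⟨ true , false , false ⟩[ _ , _ ] _ = inj₂ (inj₁ (refl , refl , refl))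
  from′ ⟨ true , true  , false ⟩[ _ , _ ] _ = inj₂ (inj₂ (refl , refl , refl))
  from′ ⟨ true , true  , true  ⟩[ _ , () ] _

infix 3 _⊨ᵇ_
_⊨ᵇ_ : FSet → Formula → Set
Γ ⊨ᵇ A = ∀ {b} → IsBivaluation b → Γ ⊆ (T ∘ b) → T (b A)

⊨⇒⊨ᵇ : ∀ {Γ A} → Γ ⊨ A → Γ ⊨ᵇ A
⊨⇒⊨ᵇ {A = A} sem bv Γ-true =
  to (designated⇔z₁ (val A))
     (sem (toValuation bv) (λ X g → from (designated⇔z₁ (val X)) (Γ-true g)))
  where val = v (toValuation bv)

⊨ᵇ⇒⊨ : ∀ {Γ A} → Γ ⊨ᵇ A → Γ ⊨ A
⊨ᵇ⇒⊨ {A = A} sem val Γ-designated =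
  from (designated⇔z₁ (v val A))
       (sem (valuation-isBivaluation val) (λ {X} g → to (designated⇔z₁ (v val X)) (Γ-designated X g)))

,,-⊆ : ∀ {Γ A} {P : FSet} → Γ ⊆ P → P A → (Γ ,, A) ⊆ P
,,-⊆ Γ⊆P a (inj₁ g)    = Γ⊆P g
,,-⊆ Γ⊆P a (inj₂ refl) = a

-- Soundness

module Truth {b : Formula → Bool} (bv : IsBivaluation b) where
  open IsBivaluation bv

  ∧-true : ∀ {A C} → T (b (A ∧' C)) ⇔ (T (b A) × T (b C))
  ∧-true = T-≡⇔ (b-∧ _ _) T-∧

  ∨-true : ∀ {A C} → T (b (A ∨' C)) ⇔ (T (b A) ⊎ T (b C))
  ∨-true = T-≡⇔ (b-∨ _ _) T-∨

  ⇒-true : ∀ {A C} → T (b (A ⇒ C)) ⇔ (T (b A) → T (b C))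
  ⇒-true = T-≡⇔ (b-⇒ _ _) T-⇛

  ¬¬-true : ∀ {A} → T (b (¬' ¬' A)) ⇔ T (b A)
  ¬¬-true = T-≡⇔ (b-¬¬ _) (mk⇔ id id)

  ¬∧-true : ∀ {A C} → T (b (¬' (A ∧' C))) ⇔ (T (b (¬' A)) ⊎ T (b (¬' C)))
  ¬∧-true = T-≡⇔ (b-¬∧ _ _) T-∨

  ¬∨-true : ∀ {A C} → T (b (¬' (A ∨' C))) ⇔ (T (b (¬' A)) × T (b (¬' C)))
  ¬∨-true = T-≡⇔ (b-¬∨ _ _) T-∧

  ¬⇒-true : ∀ {A C} → T (b (¬' (A ⇒ C))) ⇔ (T (b A) × T (b (¬' C)))
  ¬⇒-true = T-≡⇔ (b-¬⇒ _ _) T-∧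

  ∘-explosive : ∀ {A} → T (b (∘' A)) → T (b A) → T (b (¬' A)) → ⊥
  ∘-explosive {A} c a n = subst T (b-∘₂ A) (from T-∧ (a , from T-∧ (n , c)))

  ∘-exhaustive : ∀ {A} → T (b (∘' A)) → T (b A) ⊎ T (b (¬' A))
  ∘-exhaustive {A} c = to T-∨ (T-≤ (b-∘₁ A) c)

  ⇒CL-true : ∀ {A C} → T (b (A ∨' (A ⇒ C)))
  ⇒CL-true {A} with T? (b A)
  ... | yes a = from ∨-true (inj₁ a)
  ... | no ¬a = from ∨-true (inj₂ (from ⇒-true (⊥-elim ∘ ¬a)))

  sound : ∀ {Γ A} → Γ ⊢ A → Γ ⊆ (T ∘ b) → T (b A)
  sound (hyp g)     Γ-true = Γ-true g
  sound (∧I p q)    Γ-true = from ∧-true (sound p Γ-true , sound q Γ-true)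
  sound (∧E₁ p)     Γ-true = proj₁ (to ∧-true (sound p Γ-true))
  sound (∧E₂ p)     Γ-true = proj₂ (to ∧-true (sound p Γ-true))
  sound (∨I₁ p)     Γ-true = from ∨-true (inj₁ (sound p Γ-true))
  sound (∨I₂ p)     Γ-true = from ∨-true (inj₂ (sound p Γ-true))
  sound (∨E p q r)  Γ-true =
    [ sound q ∘ ,,-⊆ Γ-true , sound r ∘ ,,-⊆ Γ-true ] (to ∨-true (sound p Γ-true))
  sound (¬∧I₁ p)    Γ-true = from ¬∧-true (inj₁ (sound p Γ-true))
  sound (¬∧I₂ p)    Γ-true = from ¬∧-true (inj₂ (sound p Γ-true))
  sound (¬∧E p q r) Γ-true =
    [ sound q ∘ ,,-⊆ Γ-true , sound r ∘ ,,-⊆ Γ-true ] (to ¬∧-true (sound p Γ-true))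
  sound (¬∨I p q)   Γ-true = from ¬∨-true (sound p Γ-true , sound q Γ-true)
  sound (¬∨E₁ p)    Γ-true = proj₁ (to ¬∨-true (sound p Γ-true))
  sound (¬∨E₂ p)    Γ-true = proj₂ (to ¬∨-true (sound p Γ-true))
  sound (DNI p)     Γ-true = from ¬¬-true (sound p Γ-true)
  sound (DNE p)     Γ-true = to ¬¬-true (sound p Γ-true)
  sound (⇒I p)      Γ-true = from ⇒-true (sound p ∘ ,,-⊆ Γ-true)
  sound (⇒E p q)    Γ-true = to ⇒-true (sound p Γ-true) (sound q Γ-true)
  sound ⇒CL         Γ-true = ⇒CL-true
  sound (¬⇒I p q)   Γ-true = from ¬⇒-true (sound p Γ-true , sound q Γ-true)
  sound (¬⇒E₁ p)    Γ-true = proj₁ (to ¬⇒-true (sound p Γ-true))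
  sound (¬⇒E₂ p)    Γ-true = proj₂ (to ¬⇒-true (sound p Γ-true))
  sound (EXP∘ p q r) Γ-true =
    ⊥-elim (∘-explosive (sound p Γ-true) (sound q Γ-true) (sound r Γ-true))
  sound (PEM∘ p)    Γ-true = from ∨-true (∘-exhaustive (sound p Γ-true))

soundness : ∀ {Γ A} → Γ ⊢ A → Γ ⊨ᵇ A
soundness d bv = Truth.sound bv d

-- Completeness

-- Γ ⊢ A lives in Set₁ because its premise set is an index, so excluded
-- middle at level 0 cannot decide it.  Here the premise set Γ is a parameter
-- and the discharged assumptions are kept in a list L instead.
Hyps : FSet → List Formula → FSet
Hyps Γ L X = Γ X ⊎ X ∈ L

infix 3 _⨾_⊩_
data _⨾_⊩_ (Γ : FSet) : List Formula → Formula → Set where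
  hyp   : ∀ {L A} → Hyps Γ L A → Γ ⨾ L ⊩ A
  ∧I    : ∀ {L A B} → Γ ⨾ L ⊩ A → Γ ⨾ L ⊩ B → Γ ⨾ L ⊩ A ∧' B
  ∧E₁   : ∀ {L A B} → Γ ⨾ L ⊩ A ∧' B → Γ ⨾ L ⊩ A
  ∧E₂   : ∀ {L A B} → Γ ⨾ L ⊩ A ∧' B → Γ ⨾ L ⊩ B
  ∨I₁   : ∀ {L A B} → Γ ⨾ L ⊩ A → Γ ⨾ L ⊩ A ∨' B
  ∨I₂   : ∀ {L A B} → Γ ⨾ L ⊩ B → Γ ⨾ L ⊩ A ∨' B
  ∨E    : ∀ {L A B C} → Γ ⨾ L ⊩ A ∨' B → Γ ⨾ A ∷ L ⊩ C → Γ ⨾ B ∷ L ⊩ C → Γ ⨾ L ⊩ C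
  ¬∧I₁  : ∀ {L A B} → Γ ⨾ L ⊩ ¬' A → Γ ⨾ L ⊩ ¬' (A ∧' B)
  ¬∧I₂  : ∀ {L A B} → Γ ⨾ L ⊩ ¬' B → Γ ⨾ L ⊩ ¬' (A ∧' B)
  ¬∧E   : ∀ {L A B C} → Γ ⨾ L ⊩ ¬' (A ∧' B) → Γ ⨾ ¬' A ∷ L ⊩ C → Γ ⨾ ¬' B ∷ L ⊩ C → Γ ⨾ L ⊩ C
  ¬∨I   : ∀ {L A B} → Γ ⨾ L ⊩ ¬' A → Γ ⨾ L ⊩ ¬' B → Γ ⨾ L ⊩ ¬' (A ∨' B)
  ¬∨E₁  : ∀ {L A B} → Γ ⨾ L ⊩ ¬' (A ∨' B) → Γ ⨾ L ⊩ ¬' A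
  ¬∨E₂  : ∀ {L A B} → Γ ⨾ L ⊩ ¬' (A ∨' B) → Γ ⨾ L ⊩ ¬' B
  DNI   : ∀ {L A} → Γ ⨾ L ⊩ A → Γ ⨾ L ⊩ ¬' ¬' A
  DNE   : ∀ {L A} → Γ ⨾ L ⊩ ¬' ¬' A → Γ ⨾ L ⊩ A
  ⇒I    : ∀ {L A B} → Γ ⨾ A ∷ L ⊩ B → Γ ⨾ L ⊩ A ⇒ B
  ⇒E    : ∀ {L A B} → Γ ⨾ L ⊩ A ⇒ B → Γ ⨾ L ⊩ A → Γ ⨾ L ⊩ B
  ⇒CL   : ∀ {L A B} → Γ ⨾ L ⊩ A ∨' (A ⇒ B)
  ¬⇒I   : ∀ {L A B} → Γ ⨾ L ⊩ A → Γ ⨾ L ⊩ ¬' B → Γ ⨾ L ⊩ ¬' (A ⇒ B)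
  ¬⇒E₁  : ∀ {L A B} → Γ ⨾ L ⊩ ¬' (A ⇒ B) → Γ ⨾ L ⊩ A
  ¬⇒E₂  : ∀ {L A B} → Γ ⨾ L ⊩ ¬' (A ⇒ B) → Γ ⨾ L ⊩ ¬' B
  EXP∘  : ∀ {L A B} → Γ ⨾ L ⊩ ∘' A → Γ ⨾ L ⊩ A → Γ ⨾ L ⊩ ¬' A → Γ ⨾ L ⊩ B
  PEM∘  : ∀ {L A} → Γ ⨾ L ⊩ ∘' A → Γ ⨾ L ⊩ A ∨' ¬' A

Hyps-∷ : ∀ {Γ L Δ M Y} → Hyps Γ L ⊆ Hyps Δ M → Hyps Γ (Y ∷ L) ⊆ Hyps Δ (Y ∷ M)
Hyps-∷ ρ (inj₁ g)         = ⊎-map₂ there (ρ (inj₁ g))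
Hyps-∷ ρ (inj₂ (here eq)) = inj₂ (here eq)
Hyps-∷ ρ (inj₂ (there m)) = ⊎-map₂ there (ρ (inj₂ m))

weaken : ∀ {Γ L Δ M A} → Hyps Γ L ⊆ Hyps Δ M → Γ ⨾ L ⊩ A → Δ ⨾ M ⊩ A
weaken ρ (hyp h)      = hyp (ρ h)
weaken ρ (∧I p q)     = ∧I (weaken ρ p) (weaken ρ q)
weaken ρ (∧E₁ p)      = ∧E₁ (weaken ρ p)
weaken ρ (∧E₂ p)      = ∧E₂ (weaken ρ p)
weaken ρ (∨I₁ p)      = ∨I₁ (weaken ρ p)
weaken ρ (∨I₂ p)      = ∨I₂ (weaken ρ p)
weaken ρ (∨E p q r)   = ∨E (weaken ρ p) (weaken (Hyps-∷ ρ) q) (weaken (Hyps-∷ ρ) r)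
weaken ρ (¬∧I₁ p)     = ¬∧I₁ (weaken ρ p)
weaken ρ (¬∧I₂ p)     = ¬∧I₂ (weaken ρ p)
weaken ρ (¬∧E p q r)  = ¬∧E (weaken ρ p) (weaken (Hyps-∷ ρ) q) (weaken (Hyps-∷ ρ) r)
weaken ρ (¬∨I p q)    = ¬∨I (weaken ρ p) (weaken ρ q)
weaken ρ (¬∨E₁ p)     = ¬∨E₁ (weaken ρ p)
weaken ρ (¬∨E₂ p)     = ¬∨E₂ (weaken ρ p)
weaken ρ (DNI p)      = DNI (weaken ρ p)
weaken ρ (DNE p)      = DNE (weaken ρ p)
weaken ρ (⇒I p)       = ⇒I (weaken (Hyps-∷ ρ) p)
weaken ρ (⇒E p q)     = ⇒E (weaken ρ p) (weaken ρ q)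
weaken ρ ⇒CL          = ⇒CL
weaken ρ (¬⇒I p q)    = ¬⇒I (weaken ρ p) (weaken ρ q)
weaken ρ (¬⇒E₁ p)     = ¬⇒E₁ (weaken ρ p)
weaken ρ (¬⇒E₂ p)     = ¬⇒E₂ (weaken ρ p)
weaken ρ (EXP∘ p q r) = EXP∘ (weaken ρ p) (weaken ρ q) (weaken ρ r)
weaken ρ (PEM∘ p)     = PEM∘ (weaken ρ p)

Hyps-,, : ∀ {Γ L Δ Y} → Hyps Γ L ⊆ Δ → Hyps Γ (Y ∷ L) ⊆ (Δ ,, Y)
Hyps-,, ρ (inj₁ g)         = inj₁ (ρ (inj₁ g))
Hyps-,, ρ (inj₂ (here eq)) = inj₂ eq
Hyps-,, ρ (inj₂ (there m)) = inj₁ (ρ (inj₂ m))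

⊩⇒⊢ : ∀ {Γ L Δ A} → Hyps Γ L ⊆ Δ → Γ ⨾ L ⊩ A → Δ ⊢ A
⊩⇒⊢ ρ (hyp h)      = hyp (ρ h)
⊩⇒⊢ ρ (∧I p q)     = ∧I (⊩⇒⊢ ρ p) (⊩⇒⊢ ρ q)
⊩⇒⊢ ρ (∧E₁ p)      = ∧E₁ (⊩⇒⊢ ρ p)
⊩⇒⊢ ρ (∧E₂ p)      = ∧E₂ (⊩⇒⊢ ρ p)
⊩⇒⊢ ρ (∨I₁ p)      = ∨I₁ (⊩⇒⊢ ρ p)
⊩⇒⊢ ρ (∨I₂ p)      = ∨I₂ (⊩⇒⊢ ρ p)
⊩⇒⊢ ρ (∨E p q r)   = ∨E (⊩⇒⊢ ρ p) (⊩⇒⊢ (Hyps-,, ρ) q) (⊩⇒⊢ (Hyps-,, ρ) r)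
⊩⇒⊢ ρ (¬∧I₁ p)     = ¬∧I₁ (⊩⇒⊢ ρ p)
⊩⇒⊢ ρ (¬∧I₂ p)     = ¬∧I₂ (⊩⇒⊢ ρ p)
⊩⇒⊢ ρ (¬∧E p q r)  = ¬∧E (⊩⇒⊢ ρ p) (⊩⇒⊢ (Hyps-,, ρ) q) (⊩⇒⊢ (Hyps-,, ρ) r)
⊩⇒⊢ ρ (¬∨I p q)    = ¬∨I (⊩⇒⊢ ρ p) (⊩⇒⊢ ρ q)
⊩⇒⊢ ρ (¬∨E₁ p)     = ¬∨E₁ (⊩⇒⊢ ρ p)
⊩⇒⊢ ρ (¬∨E₂ p)     = ¬∨E₂ (⊩⇒⊢ ρ p)
⊩⇒⊢ ρ (DNI p)      = DNI (⊩⇒⊢ ρ p)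
⊩⇒⊢ ρ (DNE p)      = DNE (⊩⇒⊢ ρ p)
⊩⇒⊢ ρ (⇒I p)       = ⇒I (⊩⇒⊢ (Hyps-,, ρ) p)
⊩⇒⊢ ρ (⇒E p q)     = ⇒E (⊩⇒⊢ ρ p) (⊩⇒⊢ ρ q)
⊩⇒⊢ ρ ⇒CL          = ⇒CL
⊩⇒⊢ ρ (¬⇒I p q)    = ¬⇒I (⊩⇒⊢ ρ p) (⊩⇒⊢ ρ q)
⊩⇒⊢ ρ (¬⇒E₁ p)     = ¬⇒E₁ (⊩⇒⊢ ρ p)
⊩⇒⊢ ρ (¬⇒E₂ p)     = ¬⇒E₂ (⊩⇒⊢ ρ p)
⊩⇒⊢ ρ (EXP∘ p q r) = EXP∘ (⊩⇒⊢ ρ p) (⊩⇒⊢ ρ q) (⊩⇒⊢ ρ r)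
⊩⇒⊢ ρ (PEM∘ p)     = PEM∘ (⊩⇒⊢ ρ p)

module Chain (Δ : ℕ → FSet) (Δ-step : ∀ {n} → Δ n ⊆ Δ (suc n)) where

  Δ-mono′ : ∀ {m n} → m ≤′ n → Δ m ⊆ Δ n
  Δ-mono′ (≤′-reflexive refl) = id
  Δ-mono′ (≤′-step m≤′n)      = Δ-step ∘ Δ-mono′ m≤′n

  raise : ∀ {m n L C} → m ≤ℕ n → Δ m ⨾ L ⊩ C → Δ n ⨾ L ⊩ C
  raise m≤n = weaken (⊎-map₁ (Δ-mono′ (≤⇒≤′ m≤n)))

  AtSomeStage : List Formula → Formula → Set
  AtSomeStage L C = Σ ℕ λ n → Δ n ⨾ L ⊩ C

  rule₁ : ∀ {L C L₁ C₁} → (∀ {n} → Δ n ⨾ L₁ ⊩ C₁ → Δ n ⨾ L ⊩ C) →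
          AtSomeStage L₁ C₁ → AtSomeStage L C
  rule₁ r (n , p) = n , r p

  rule₂ : ∀ {L C L₁ C₁ L₂ C₂} →
          (∀ {n} → Δ n ⨾ L₁ ⊩ C₁ → Δ n ⨾ L₂ ⊩ C₂ → Δ n ⨾ L ⊩ C) →
          AtSomeStage L₁ C₁ → AtSomeStage L₂ C₂ → AtSomeStage L C
  rule₂ r (m , p) (n , q) = m ⊔ n , r (raise (m≤m⊔n m n) p) (raise (m≤n⊔m m n) q)

  rule₃ : ∀ {L C L₁ C₁ L₂ C₂ L₃ C₃} →
          (∀ {n} → Δ n ⨾ L₁ ⊩ C₁ → Δ n ⨾ L₂ ⊩ C₂ → Δ n ⨾ L₃ ⊩ C₃ → Δ n ⨾ L ⊩ C) →
          AtSomeStage L₁ C₁ → AtSomeStage L₂ C₂ → AtSomeStage L₃ C₃ → AtSomeStage L C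
  rule₃ r (m , p) (n , q) (k , s) =
    m ⊔ (n ⊔ k) , r (raise (m≤m⊔n m (n ⊔ k)) p)
                    (raise (≤-trans (m≤m⊔n n k) (m≤n⊔m m (n ⊔ k))) q)
                    (raise (≤-trans (m≤n⊔m n k) (m≤n⊔m m (n ⊔ k))) s)

  compact : ∀ {L C} → ⋃ ℕ Δ ⨾ L ⊩ C → AtSomeStage L C
  compact (hyp (inj₁ (n , x))) = n , hyp (inj₁ x)
  compact (hyp (inj₂ m))       = 0 , hyp (inj₂ m)
  compact (∧I p q)     = rule₂ ∧I (compact p) (compact q)
  compact (∧E₁ p)      = rule₁ ∧E₁ (compact p)
  compact (∧E₂ p)      = rule₁ ∧E₂ (compact p)
  compact (∨I₁ p)      = rule₁ ∨I₁ (compact p)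
  compact (∨I₂ p)      = rule₁ ∨I₂ (compact p)
  compact (∨E p q r)   = rule₃ ∨E (compact p) (compact q) (compact r)
  compact (¬∧I₁ p)     = rule₁ ¬∧I₁ (compact p)
  compact (¬∧I₂ p)     = rule₁ ¬∧I₂ (compact p)
  compact (¬∧E p q r)  = rule₃ ¬∧E (compact p) (compact q) (compact r)
  compact (¬∨I p q)    = rule₂ ¬∨I (compact p) (compact q)
  compact (¬∨E₁ p)     = rule₁ ¬∨E₁ (compact p)
  compact (¬∨E₂ p)     = rule₁ ¬∨E₂ (compact p)
  compact (DNI p)      = rule₁ DNI (compact p)
  compact (DNE p)      = rule₁ DNE (compact p)
  compact (⇒I p)       = rule₁ ⇒I (compact p)
  compact (⇒E p q)     = rule₂ ⇒E (compact p) (compact q)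
  compact ⇒CL          = 0 , ⇒CL
  compact (¬⇒I p q)    = rule₂ ¬⇒I (compact p) (compact q)
  compact (¬⇒E₁ p)     = rule₁ ¬⇒E₁ (compact p)
  compact (¬⇒E₂ p)     = rule₁ ¬⇒E₂ (compact p)
  compact (EXP∘ p q r) = rule₃ EXP∘ (compact p) (compact q) (compact r)
  compact (PEM∘ p)     = rule₁ PEM∘ (compact p)

module MaximalTheory (em : ExcludedMiddle 0ℓ) {Δ : FSet} {A : Formula}
                     (Δ⊬A : ¬ (Δ ⨾ [] ⊩ A))
                     (Δ-maximal : ∀ X → ¬ Δ X → Δ ⨾ X ∷ [] ⊩ A) where

  member : Formula → Bool
  member X = does (em {Δ X})

  T-member : ∀ {X} → T (member X) ⇔ Δ X
  T-member = T-does em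

  closed : ∀ {X} → Δ ⨾ [] ⊩ X → Δ X
  closed {X} d with em {Δ X}
  ... | yes x = x
  ... | no ¬x = ⊥-elim (Δ⊬A (⇒E (⇒I (Δ-maximal X ¬x)) d))

  prime : ∀ {X Y} → Δ ⨾ [] ⊩ X ∨' Y → Δ X ⊎ Δ Y
  prime {X} {Y} d with em {Δ X} | em {Δ Y}
  ... | yes x | _     = inj₁ x
  ... | no _  | yes y = inj₂ y
  ... | no ¬x | no ¬y = ⊥-elim (Δ⊬A (∨E d (Δ-maximal X ¬x) (Δ-maximal Y ¬y)))

  premise : ∀ {L X} → Δ X → Δ ⨾ L ⊩ X
  premise x = hyp (inj₁ x)

  assumption : ∀ {L X} → Δ ⨾ X ∷ L ⊩ X
  assumption = hyp (inj₂ (here refl))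

  ∧-closed : ∀ {X Y} → Δ (X ∧' Y) ⇔ (Δ X × Δ Y)
  ∧-closed = mk⇔ (λ d → closed (∧E₁ (premise d)) , closed (∧E₂ (premise d)))
                 (λ (x , y) → closed (∧I (premise x) (premise y)))

  ∨-closed : ∀ {X Y} → Δ (X ∨' Y) ⇔ (Δ X ⊎ Δ Y)
  ∨-closed = mk⇔ (prime ∘ premise)
                 [ (λ x → closed (∨I₁ (premise x))) , (λ y → closed (∨I₂ (premise y))) ]

  ⇒-closed : ∀ {X Y} → Δ (X ⇒ Y) ⇔ (Δ X → Δ Y)
  ⇒-closed {X} {Y} = mk⇔ (λ d x → closed (⇒E (premise d) (premise x))) ⇒-intro
    where
    ⇒-intro : (Δ X → Δ Y) → Δ (X ⇒ Y)
    ⇒-intro f with em {Δ X}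
    ... | yes x = closed (⇒I (premise (f x)))
    ... | no ¬x = [ ⊥-elim ∘ ¬x , id ] (prime ⇒CL)

  ¬¬-closed : ∀ {X} → Δ (¬' ¬' X) ⇔ Δ X
  ¬¬-closed = mk⇔ (λ d → closed (DNE (premise d))) (λ x → closed (DNI (premise x)))

  ¬∧-closed : ∀ {X Y} → Δ (¬' (X ∧' Y)) ⇔ (Δ (¬' X) ⊎ Δ (¬' Y))
  ¬∧-closed = mk⇔ (λ d → prime (¬∧E (premise d) (∨I₁ assumption) (∨I₂ assumption)))
                  [ (λ x → closed (¬∧I₁ (premise x))) , (λ y → closed (¬∧I₂ (premise y))) ]

  ¬∨-closed : ∀ {X Y} → Δ (¬' (X ∨' Y)) ⇔ (Δ (¬' X) × Δ (¬' Y))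
  ¬∨-closed = mk⇔ (λ d → closed (¬∨E₁ (premise d)) , closed (¬∨E₂ (premise d)))
                  (λ (x , y) → closed (¬∨I (premise x) (premise y)))

  ¬⇒-closed : ∀ {X Y} → Δ (¬' (X ⇒ Y)) ⇔ (Δ X × Δ (¬' Y))
  ¬⇒-closed = mk⇔ (λ d → closed (¬⇒E₁ (premise d)) , closed (¬⇒E₂ (premise d)))
                  (λ (x , y) → closed (¬⇒I (premise x) (premise y)))

  member-isBivaluation : IsBivaluation member
  member-isBivaluation = record
    { b-∧  = λ X Y → does-⇔ ∧-closed em (em ×-dec em)
    ; b-∨  = λ X Y → does-⇔ ∨-closed em (em ⊎-dec em)
    ; b-⇒  = λ X Y → does-⇔ ⇒-closed em (em →-dec em)
    ; b-¬¬ = λ X → does-⇔ ¬¬-closed em em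
    ; b-¬∧ = λ X Y → does-⇔ ¬∧-closed em (em ⊎-dec em)
    ; b-¬∨ = λ X Y → does-⇔ ¬∨-closed em (em ×-dec em)
    ; b-¬⇒ = λ X Y → does-⇔ ¬⇒-closed em (em ×-dec em)
    ; b-∘₁ = λ X → does-mono (λ c → prime (PEM∘ (premise c))) em (em ⊎-dec em)
    ; b-∘₂ = λ X → dec-false (em ×-dec em ×-dec em)
                     (λ (x , ¬x , ∘x) → Δ⊬A (EXP∘ (premise ∘x) (premise x) (premise ¬x)))
    }

-- A formula is written in reverse Polish notation as a binary numeral, one
-- three-digit word per token, the variable n being var₀ followed by n
-- successor words; run is the stack machine reading such a numeral back.
-- Numerals that encode no formula are sent to var 0 by enum.
pattern var₀-word r = 1+[2 1+[2 1+[2 r ] ] ]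
pattern suc-word r  = 1+[2 1+[2 2[1+ r ] ] ]
pattern ∧-word r    = 1+[2 2[1+ 1+[2 r ] ] ]
pattern ∨-word r    = 1+[2 2[1+ 2[1+ r ] ] ]
pattern ⇒-word r    = 2[1+ 1+[2 1+[2 r ] ] ]
pattern ¬-word r    = 2[1+ 1+[2 2[1+ r ] ] ]
pattern ∘-word r    = 2[1+ 2[1+ 1+[2 r ] ] ]

run : ℕᵇ → List Formula → List Formula
run (var₀-word r) s           = run r (var 0 ∷ s)
run (suc-word r)  (var n ∷ s) = run r (var (suc n) ∷ s)
run (∧-word r)    (C ∷ A ∷ s) = run r ((A ∧' C) ∷ s)
run (∨-word r)    (C ∷ A ∷ s) = run r ((A ∨' C) ∷ s)
run (⇒-word r)    (C ∷ A ∷ s) = run r ((A ⇒ C) ∷ s)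
run (¬-word r)    (A ∷ s)     = run r ((¬' A) ∷ s)
run (∘-word r)    (A ∷ s)     = run r ((∘' A) ∷ s)
run _             s           = s

var-words : ℕ → ℕᵇ → ℕᵇ
var-words zero    r = var₀-word r
var-words (suc n) r = var-words n (suc-word r)

encode : Formula → ℕᵇ → ℕᵇ
encode (var n)  r = var-words n r
encode (A ∧' C) r = encode A (encode C (∧-word r))
encode (A ∨' C) r = encode A (encode C (∨-word r))
encode (A ⇒ C)  r = encode A (encode C (⇒-word r))
encode (¬' A)   r = encode A (¬-word r)
encode (∘' A)   r = encode A (∘-word r)

run-var-words : ∀ n r s → run (var-words n r) s ≡ run r (var n ∷ s)
run-var-words zero    r s = refl
run-var-words (suc n) r s = run-var-words n (suc-word r) s

run-encode : ∀ A r s → run (encode A r) s ≡ run r (A ∷ s)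
run-encode (var n)  r s = run-var-words n r s
run-encode (A ∧' C) r s = trans (run-encode A _ s) (run-encode C _ (A ∷ s))
run-encode (A ∨' C) r s = trans (run-encode A _ s) (run-encode C _ (A ∷ s))
run-encode (A ⇒ C)  r s = trans (run-encode A _ s) (run-encode C _ (A ∷ s))
run-encode (¬' A)   r s = run-encode A _ s
run-encode (∘' A)   r s = run-encode A _ s

code : Formula → ℕ
code A = toℕ (encode A 0ᵇ)

enum : ℕ → Formula
enum n = fromMaybe (var 0) (head (run (fromℕ n) []))

enum-code : ∀ A → enum (code A) ≡ A
enum-code A rewrite fromℕ-toℕ (encode A 0ᵇ) | run-encode A 0ᵇ [] = refl

module Lindenbaum (em : ExcludedMiddle 0ℓ) (Γ : FSet) (A : Formula) (Γ⊬A : ¬ (Γ ⨾ [] ⊩ A)) where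

  stage : ℕ → FSet
  stage zero    = Γ
  stage (suc n) X = stage n X ⊎ (X ≡ enum n × ¬ (stage n ⨾ X ∷ [] ⊩ A))

  open Chain stage inj₁

  Δ : FSet
  Δ = ⋃ ℕ stage

  Γ⊆Δ : Γ ⊆ Δ
  Γ⊆Δ x = 0 , x

  stage⊬A : ∀ n → ¬ (stage n ⨾ [] ⊩ A)
  stage⊬A zero    = Γ⊬A
  stage⊬A (suc n) d with em {stage n ⨾ enum n ∷ [] ⊩ A}
  ... | yes d′ = stage⊬A n (weaken (λ { (inj₁ (inj₁ x)) → inj₁ x
                                      ; (inj₁ (inj₂ (refl , ¬d′))) → ⊥-elim (¬d′ d′) }) d)
  ... | no ¬d′ = ¬d′ (weaken (λ { (inj₁ (inj₁ x)) → inj₁ x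
                                 ; (inj₁ (inj₂ (refl , _))) → inj₂ (here refl) }) d)

  Δ⊬A : ¬ (Δ ⨾ [] ⊩ A)
  Δ⊬A d = let n , d′ = compact d in stage⊬A n d′

  Δ-maximal : ∀ X → ¬ Δ X → Δ ⨾ X ∷ [] ⊩ A
  Δ-maximal X ¬x with em {stage (code X) ⨾ X ∷ [] ⊩ A}
  ... | yes d = weaken (⊎-map₁ (code X ,_)) d
  ... | no ¬d = ⊥-elim (¬x (suc (code X) , inj₂ (sym (enum-code X) , ¬d)))

completeness : ExcludedMiddle 0ℓ → ∀ {Γ A} → Γ ⊨ᵇ A → Γ ⊢ A
completeness em {Γ} {A} sem with em {Γ ⨾ [] ⊩ A}
... | yes d    = ⊩⇒⊢ [ id , (λ ()) ] d
... | no Γ⊬A = ⊥-elim (Δ⊬A (premise A∈Δ))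
  where
  open Lindenbaum em Γ A Γ⊬A
  open MaximalTheory em Δ⊬A Δ-maximal
  A∈Δ : Δ A
  A∈Δ = to T-member (sem member-isBivaluation (from T-member ∘ Γ⊆Δ))

theorem2p17 : ExcludedMiddle 0ℓ → (Γ : FSet) (A : Formula) → (Γ ⊨ A) ⇔ (Γ ⊢ A)
theorem2p17 em Γ A = mk⇔ (completeness em ∘ ⊨⇒⊨ᵇ) (⊨ᵇ⇒⊨ ∘ soundness)
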